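{- Let $s \in \{2,3\}$ and let $G = C_5 \rtimes_s C_4$ be the group generated by $x$ and $y$ subject to $x^4 = 1$, $y^5 = 1$, $yx = xy^s$, and let $H = \langle y \rangle$. Let $S$ be a sequence in $G$ with $|S| = 7$ such that, for some $i \in \{1,3\}$, every term of $S$ lies in the coset $x^iH$. Then $S$ is not free of product-$1$ subsequences.
   Context: A sequence $S=(g_1,\dots,g_l)$ in a finite group is a finite list of elements (repetitions allowed), $|S|=l$ its length. A subsequence $(g_{n_1},\dots,g_{n_k})$ (nonempty index set) is a product-$1$ subsequence if $g_{\sigma(n_1)}\cdots g_{\sigma(n_k)}=1$ for some permutation $\sigma$ of its indices; $S$ is free of product-$1$ subsequences if it has no such subsequence. -}

module Defs where

open import Data.Nat using (ℕ; zero; suc; _+_; _*_; _^_)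
open import Data.Nat.DivMod using (_mod_)
open import Data.Fin using (Fin; toℕ)
open import Data.Product using (_×_; _,_; ∃)
open import Data.List using (List; []; foldr)
open import Data.List.Relation.Binary.Sublist.Propositional using (_⊆_)
open import Data.List.Relation.Binary.Permutation.Propositional using (_↭_)
open import Relation.Binary.PropositionalEquality using (_≡_; _≢_; refl)
open import Relation.Nullary using (¬_)

-- Concrete model of C₅ ⋊ₛ C₄ = ⟨ x, y | x⁴ = 1, y⁵ = 1, yx = xyˢ ⟩ :
-- the element (a , b) stands for x^a y^b  (a mod 4, b mod 5).
-- Since y^b x^c = x^c y^(b sᶜ), we get
--   (x^a y^b)(x^c y^d) = x^(a+c) y^(b sᶜ + d).
G : Set
G = Fin 4 × Fin 5

mul : ℕ → G → G → G
mul s (a , b) (c , d) =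
  ((toℕ a + toℕ c) mod 4 , (toℕ b * s ^ toℕ c + toℕ d) mod 5)

one : G
one = (0 mod 4 , 0 mod 5)

gx : G
gx = (1 mod 4 , 0 mod 5)

gy : G
gy = (0 mod 4 , 1 mod 5)

pow : ℕ → G → ℕ → G
pow s g zero = one
pow s g (suc n) = mul s g (pow s g n)

rel-x⁴-2 : pow 2 gx 4 ≡ one
rel-x⁴-2 = refl
rel-y⁵-2 : pow 2 gy 5 ≡ one
rel-y⁵-2 = refl
rel-yx-2 : mul 2 gy gx ≡ mul 2 gx (pow 2 gy 2)
rel-yx-2 = refl
rel-x⁴-3 : pow 3 gx 4 ≡ one
rel-x⁴-3 = refl
rel-y⁵-3 : pow 3 gy 5 ≡ one
rel-y⁵-3 = refl
rel-yx-3 : mul 3 gy gx ≡ mul 3 gx (pow 3 gy 3)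
rel-yx-3 = refl

InCoset : ℕ → ℕ → G → Set
InCoset s i g = ∃ λ k → g ≡ mul s (pow s gx i) (pow s gy k)

prod : ℕ → List G → G
prod s = foldr (mul s) one

HasProductOne : ℕ → List G → Set
HasProductOne s S =
  ∃ λ (T : List G) → T ⊆ S × T ≢ [] × ∃ λ (T' : List G) → T' ↭ T × prod s T' ≡ one

ProductOneFree : ℕ → List G → Set
ProductOneFree s S = ¬ HasProductOne s S

{-# OPTIONS --safe #-}
-- Every element of an odd coset x^a H is x^a y^β.  Since s² ≡ -1 (mod 5) and a
-- is odd, the y-exponent of a product of four such elements is
-- ±s (β₁ - β₃) + (β₄ - β₂), so it vanishes both on orderings of the form
-- (β, γ, β, γ) and on one ordering of a suitable quadruple of distinct
-- exponents; both facts are checked by evaluation.  A length-7 sequence in the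
-- coset either contains that quadruple, or it avoids one of the five exponents;
-- then its 7 terms take at most 4 values, and a pigeonhole count yields two
-- disjoint pairs of equal terms.
module Submission where

open import Defs
open import Data.Nat using (ℕ; zero; suc; _+_; _*_; _≤_; s≤s⁻¹; NonZero)
open import Data.Nat.DivMod using (_mod_; m<n⇒m%n≡m)
open import Data.Nat.Properties using (+-suc; *-suc; +-identityʳ; suc-injective; ≤-refl)
open import Data.Fin using (Fin; toℕ; zero; #_)
open import Data.Fin.Properties using (all?; _≟_; toℕ-injective; toℕ-fromℕ<; toℕ<n)
open import Data.Product using (∃-syntax; _×_; _,_; proj₁)
open import Data.Product.Properties using (≡-dec)
open import Data.List using (List; []; _∷_; _++_; length; map; allFin)
open import Data.List.Membership.Propositional using (_∈_; _∉_; find)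
open import Data.List.Membership.Propositional.Properties using (∈-∃++; ∈-++⁺ˡ; ∈-map⁺; ∈-allFin)
open import Data.List.Relation.Unary.Any using (here; there)
open import Data.List.Relation.Unary.All as All using (All; []; _∷_)
open import Data.List.Relation.Unary.All.Properties using (¬All⇒Any¬)
open import Data.List.Relation.Unary.AllPairs using ([]; _∷_)
open import Data.List.Relation.Unary.Unique.Propositional using (Unique)
open import Data.List.Relation.Unary.Unique.DecPropositional using (unique?)
open import Data.List.Relation.Binary.Sublist.Propositional using (_⊆_; []; _∷_; _∷ʳ_; ⊆-refl)
import Data.List.Relation.Binary.Sublist.Propositional.Properties as Sublist
open import Data.List.Relation.Binary.Permutation.Propositional
  using (_↭_; refl; prep; swap; trans; ↭-sym)
open import Data.List.Relation.Binary.Permutation.Propositional.Properties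
  using (shift; ++⁺ʳ; ↭-length; ↭-empty-inv; ∈-resp-↭; All-resp-↭)
open import Data.Sum using (_⊎_; inj₁; inj₂)
open import Relation.Binary.Definitions using (DecidableEquality)
open import Relation.Binary.PropositionalEquality as ≡ using (_≡_; _≢_; refl; sym; cong; subst; subst₂)
open import Relation.Nullary using (¬_; yes; no; contradiction)
open import Relation.Nullary.Decidable using (True; toWitness)

2*suc-≤-pred : ∀ m n {k} → 2 * suc m + n ≤ suc k → suc (2 * m + n) ≤ k
2*suc-≤-pred m n {k} h = s≤s⁻¹ (subst (_≤ suc k) (cong (_+ n) (*-suc 2 m)) h)

+suc-≤-pred : ∀ m n {k} → m + suc n ≤ suc k → m + n ≤ k
+suc-≤-pred m n {k} h = s≤s⁻¹ (subst (_≤ suc k) (+-suc m n) h)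

module _ {A : Set} where

  ⊆-resp-↭ : {xs ys zs : List A} → xs ⊆ ys → ys ↭ zs → ∃[ ws ] ws ⊆ zs × ws ↭ xs
  ⊆-resp-↭ τ refl = _ , τ , refl
  ⊆-resp-↭ (x ∷ʳ τ) (prep x p)
    with ws , σ , q ← ⊆-resp-↭ τ p = ws , x ∷ʳ σ , q
  ⊆-resp-↭ (refl ∷ τ) (prep x p)
    with ws , σ , q ← ⊆-resp-↭ τ p = x ∷ ws , refl ∷ σ , prep x q
  ⊆-resp-↭ (x ∷ʳ y ∷ʳ τ) (swap x y p)
    with ws , σ , q ← ⊆-resp-↭ τ p = ws , y ∷ʳ x ∷ʳ σ , q
  ⊆-resp-↭ (x ∷ʳ refl ∷ τ) (swap x y p)
    with ws , σ , q ← ⊆-resp-↭ τ p = y ∷ ws , refl ∷ x ∷ʳ σ , prep y q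
  ⊆-resp-↭ (refl ∷ y ∷ʳ τ) (swap x y p)
    with ws , σ , q ← ⊆-resp-↭ τ p = x ∷ ws , y ∷ʳ refl ∷ σ , prep x q
  ⊆-resp-↭ (refl ∷ refl ∷ τ) (swap x y p)
    with ws , σ , q ← ⊆-resp-↭ τ p = y ∷ x ∷ ws , refl ∷ refl ∷ σ , swap y x q
  ⊆-resp-↭ τ (trans p p′)
    with ws , σ , q ← ⊆-resp-↭ τ p
    with vs , σ′ , q′ ← ⊆-resp-↭ σ p′ = vs , σ′ , trans q′ q

  infix 4 _⊑_
  _⊑_ : List A → List A → Set
  ys ⊑ xs = ∃[ zs ] ys ++ zs ↭ xs

  ⊑⇒⊆ : {ys xs : List A} → ys ⊑ xs → ∃[ ws ] ws ⊆ xs × ws ↭ ys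
  ⊑⇒⊆ (zs , p) = ⊆-resp-↭ (Sublist.++⁺ʳ zs ⊆-refl) p

  ∈-⊑ : {x : A} {ys xs : List A} → x ∈ ys → ys ⊑ xs → x ∈ xs
  ∈-⊑ x∈ys (_ , p) = ∈-resp-↭ p (∈-++⁺ˡ x∈ys)

  []⊑ : (xs : List A) → [] ⊑ xs
  []⊑ xs = xs , refl

  ∷-⊑-∷ : {x : A} {ys xs : List A} → ys ⊑ xs → x ∷ ys ⊑ x ∷ xs
  ∷-⊑-∷ {x} (zs , p) = zs , prep x p

  ⊑-∷ : {x : A} {ys xs : List A} → ys ⊑ xs → ys ⊑ x ∷ xs
  ⊑-∷ {x} {ys} (zs , p) = x ∷ zs , trans (shift x ys zs) (prep x p)

  ⊑-resp-↭ : {ys xs xs′ : List A} → ys ⊑ xs → xs ↭ xs′ → ys ⊑ xs′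
  ⊑-resp-↭ (zs , p) q = zs , trans p q

  ↭-⊑ : {ys′ ys xs : List A} → ys′ ↭ ys → ys ⊑ xs → ys′ ⊑ xs
  ↭-⊑ q (zs , p) = zs , trans (++⁺ʳ zs q) p

  ∈⇒↭∷ : {x : A} {xs : List A} → x ∈ xs → ∃[ ys ] xs ↭ x ∷ ys
  ∈⇒↭∷ {x} x∈xs with us , vs , refl ← ∈-∃++ x∈xs = us ++ vs , shift x us vs

  ∈-↭∷⁻ : {x y : A} {xs ys : List A} → y ∈ xs → xs ↭ x ∷ ys → y ≢ x → y ∈ ys
  ∈-↭∷⁻ y∈xs p y≢x with ∈-resp-↭ p y∈xs
  ... | here y≡x = contradiction y≡x y≢x
  ... | there y∈ys = y∈ys

  All∈-remove : {x : A} {vals xs : List A} → All (_∈ vals) xs → x ∈ vals → x ∉ xs →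
                ∃[ vals′ ] length vals ≡ suc (length vals′) × All (_∈ vals′) xs
  All∈-remove xs⊆vals x∈vals x∉xs with vals′ , p ← ∈⇒↭∷ x∈vals =
    vals′ , ↭-length p ,
    All.tabulate λ y∈xs → ∈-↭∷⁻ (All.lookup xs⊆vals y∈xs) p λ { refl → x∉xs y∈xs }

  Unique∧All∈⇒⊑ : {ys xs : List A} → Unique ys → All (_∈ xs) ys → ys ⊑ xs
  Unique∧All∈⇒⊑ [] [] = []⊑ _
  Unique∧All∈⇒⊑ {_ ∷ ys} (y≢ys ∷ ys-unique) (y∈xs ∷ ys⊆xs) with xs′ , p ← ∈⇒↭∷ y∈xs =
    ⊑-resp-↭ (∷-⊑-∷ (Unique∧All∈⇒⊑ ys-unique ys⊆xs′)) (↭-sym p)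
    where
    ys⊆xs′ : All (_∈ xs′) ys
    ys⊆xs′ = All.zipWith (λ (y′∈xs , y≢y′) → ∈-↭∷⁻ y′∈xs p (λ y′≡y → y≢y′ (sym y′≡y)))
                         (ys⊆xs , y≢ys)

  doubled : List A → List A
  doubled [] = []
  doubled (b ∷ bs) = b ∷ b ∷ doubled bs

  module _ (_≟_ : DecidableEquality A) where
    open import Data.List.Membership.DecPropositional _≟_ using (_∈?_)

    -- Pigeonhole: 2m − 1 more terms than available values force m disjoint pairs of equal terms.
    doubled-⊑ : (m : ℕ) {vals xs : List A} → All (_∈ vals) xs →
                2 * m + length vals ≤ suc (length xs) → ∃[ bs ] length bs ≡ m × doubled bs ⊑ xs
    doubled-⊑ zero _ _ = [] , refl , []⊑ _
    doubled-⊑ (suc m) = pair-off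
      where
      pair-off : {vals xs : List A} → All (_∈ vals) xs →
                 2 * suc m + length vals ≤ suc (length xs) → ∃[ bs ] length bs ≡ suc m × doubled bs ⊑ xs
      pair-off {vals} {[]} _ h with 2*suc-≤-pred m (length vals) h
      ... | ()
      pair-off {vals} {x ∷ xs} (x∈vals ∷ xs⊆vals) h with x ∈? xs
      ... | yes x∈xs with xs′ , p ← ∈⇒↭∷ x∈xs
                     with bs , refl , bs⊑xs′ ← doubled-⊑ m (All.tail (All-resp-↭ p xs⊆vals))
                       (subst (2 * m + length vals ≤_) (↭-length p) (s≤s⁻¹ (2*suc-≤-pred m (length vals) h)))
        = x ∷ bs , refl , ⊑-resp-↭ (∷-⊑-∷ (∷-⊑-∷ bs⊑xs′)) (prep x (↭-sym p))
      ... | no x∉xs with vals′ , |vals| , xs⊆vals′ ← All∈-remove xs⊆vals x∈vals x∉xs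
                    with bs , |bs| , bs⊑xs ← pair-off xs⊆vals′
                      (+suc-≤-pred (2 * suc m) (length vals′)
                        (subst (λ l → 2 * suc m + l ≤ suc (length (x ∷ xs))) |vals| h))
        = bs , |bs| , ⊑-∷ bs⊑xs

_≟ᴳ_ : DecidableEquality G
_≟ᴳ_ = ≡-dec _≟_ _≟_

open import Data.List.Membership.DecPropositional _≟ᴳ_ using (_∈?_)

⊑⇒HasProductOne : {s : ℕ} {ys S : List G} → ys ⊑ S → ys ≢ [] → prod s ys ≡ one → HasProductOne s S
⊑⇒HasProductOne {ys = ys} ys⊑S ys≢[] ys-product with T , T⊆S , T↭ys ← ⊑⇒⊆ ys⊑S =
  T , T⊆S , (λ { refl → ys≢[] (↭-empty-inv (↭-sym T↭ys)) }) , ys , ↭-sym T↭ys , ys-product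

toℕ-mod : {n : ℕ} .{{_ : NonZero n}} (a : Fin n) → toℕ a mod n ≡ a
toℕ-mod a = toℕ-injective (≡.trans (toℕ-fromℕ< _) (m<n⇒m%n≡m (toℕ<n a)))

Coset : Fin 4 → G → Set
Coset a g = proj₁ g ≡ a

proj₁-pow-gy : ∀ s k → proj₁ (pow s gy k) ≡ zero
proj₁-pow-gy s zero = refl
proj₁-pow-gy s (suc k) rewrite proj₁-pow-gy s k = refl

InCoset⇒Coset : ∀ {s i g} → InCoset s i g → Coset (proj₁ (pow s gx i)) g
InCoset⇒Coset {s} {i} (k , refl)
  rewrite proj₁-pow-gy s k | +-identityʳ (toℕ (proj₁ (pow s gx i))) = toℕ-mod _

record ProductOneWitnesses (s : ℕ) (a : Fin 4) : Set where
  field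
    alternating-product : ∀ β γ → prod s ((a , β) ∷ (a , γ) ∷ (a , β) ∷ (a , γ) ∷ []) ≡ one
    quadruple : List G
    quadruple-unique : Unique quadruple
    quadruple-⊆-coset : All (Coset a) quadruple
    quadruple-nonempty : quadruple ≢ []
    quadruple-product : prod s quadruple ≡ one

byComputation : (s : ℕ) (a : Fin 4) (p q r t : Fin 5) →
  {True (all? λ β → all? λ γ → prod s ((a , β) ∷ (a , γ) ∷ (a , β) ∷ (a , γ) ∷ []) ≟ᴳ one)} →
  {True (unique? _≟ᴳ_ ((a , p) ∷ (a , q) ∷ (a , r) ∷ (a , t) ∷ []))} →
  {True (prod s ((a , p) ∷ (a , q) ∷ (a , r) ∷ (a , t) ∷ []) ≟ᴳ one)} →
  ProductOneWitnesses s a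
byComputation s a p q r t {alternating} {unique} {product} = record
  { alternating-product = toWitness alternating
  ; quadruple = (a , p) ∷ (a , q) ∷ (a , r) ∷ (a , t) ∷ []
  ; quadruple-unique = toWitness unique
  ; quadruple-⊆-coset = refl ∷ refl ∷ refl ∷ refl ∷ []
  ; quadruple-nonempty = λ ()
  ; quadruple-product = toWitness product
  }

witnesses : ∀ {s i} → s ≡ 2 ⊎ s ≡ 3 → i ≡ 1 ⊎ i ≡ 3 → ProductOneWitnesses s (proj₁ (pow s gx i))
witnesses (inj₁ refl) (inj₁ refl) = byComputation 2 _ (# 0) (# 1) (# 4) (# 3)
witnesses (inj₁ refl) (inj₂ refl) = byComputation 2 _ (# 0) (# 1) (# 3) (# 2)
witnesses (inj₂ refl) (inj₁ refl) = byComputation 3 _ (# 0) (# 1) (# 3) (# 2)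
witnesses (inj₂ refl) (inj₂ refl) = byComputation 3 _ (# 0) (# 1) (# 4) (# 3)

module _ {s : ℕ} {a : Fin 4} (W : ProductOneWitnesses s a) where
  open ProductOneWitnesses W

  coset : List G
  coset = map (a ,_) (allFin 5)

  ∈-coset : ∀ {g} → Coset a g → g ∈ coset
  ∈-coset {_ , β} refl = ∈-map⁺ (a ,_) (∈-allFin β)

  coset-alternating-product : ∀ {g h} → Coset a g → Coset a h → prod s (g ∷ h ∷ g ∷ h ∷ []) ≡ one
  coset-alternating-product {_ , β} {_ , γ} refl refl = alternating-product β γ

  length≡7⇒HasProductOne : (S : List G) → length S ≡ 7 → All (Coset a) S → HasProductOne s S
  length≡7⇒HasProductOne S |S| S⊆coset with All.all? (_∈? S) quadruple
  ... | yes W⊆S = ⊑⇒HasProductOne (Unique∧All∈⇒⊑ quadruple-unique W⊆S) quadruple-nonempty quadruple-product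
  ... | no W⊈S
    with w , w∈W , w∉S ← find (¬All⇒Any¬ (_∈? S) quadruple W⊈S)
    with vals , |coset| , S⊆vals ← All∈-remove (All.map ∈-coset S⊆coset)
                                     (∈-coset (All.lookup quadruple-⊆-coset w∈W)) w∉S
    with b ∷ c ∷ [] , refl , bbcc⊑S ← doubled-⊑ _≟ᴳ_ 2 S⊆vals
           (subst₂ (λ l l′ → 4 + l ≤ suc l′) (suc-injective |coset|) (sym |S|) ≤-refl)
    = ⊑⇒HasProductOne (↭-⊑ (prep b (swap c b refl)) bbcc⊑S) (λ ())
        (coset-alternating-product {b} {c} (in-coset b (here refl)) (in-coset c (there (there (here refl)))))
    where
    in-coset : ∀ g → g ∈ doubled (b ∷ c ∷ []) → Coset a g
    in-coset g g∈bbcc = All.lookup S⊆coset (∈-⊑ g∈bbcc bbcc⊑S)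

proposition4p2 : (s : ℕ) → (s ≡ 2 ⊎ s ≡ 3) → (S : List G) → length S ≡ 7 →
    (i : ℕ) → (i ≡ 1 ⊎ i ≡ 3) → All (InCoset s i) S → ¬ ProductOneFree s S
proposition4p2 s s∈ S |S| i i∈ S⊆xⁱH productOneFree =
  productOneFree (length≡7⇒HasProductOne (witnesses s∈ i∈) S |S| (All.map (InCoset⇒Coset {s} {i}) S⊆xⁱH))
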